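{- Let $n\ge2$ and $\lambda=(\lambda_1,\dots,\lambda_d)$ a partition of $n$ with $\gcd(n-1,\lambda_t)=1$ for every $t$. For distinct $i,j\in\{1,\dots,n-2\}$, we have $i\preceq j$ in $P(\lambda)$ if and only if $i<j$ and $s_{t,i}>s_{t,j}>0$ for every $t\in\{1,\dots,d\}$.
   Context: $\Delta_\lambda=\mathrm{conv}(e_1,\dots,e_d,\lambda)\subset\mathbb{R}^d$ ($e_i$ standard basis vectors), with fundamental parallelepiped $\Pi_\lambda=\{\sum_{i=1}^d\gamma_i(1,e_i)+\gamma_{d+1}(1,\lambda): 0\le\gamma_i<1\}$. The poset $P(\lambda)$ is $\Pi_\lambda\cap\mathbb{Z}^{d+1}$ with $\sigma\preceq\mu$ iff $\mu-\sigma\in\Pi_\lambda\cap\mathbb{Z}^{d+1}$; its elements are identified with $b\in\{0,\dots,n-2\}$ via the bijection $b\mapsto p(b)=\big((\sum_{t}\lceil b\lambda_t/(n-1)\rceil)-b,\lceil b\lambda_1/(n-1)\rceil,\dots,\lceil b\lambda_d/(n-1)\rceil\big)$. For $0\le i<n-1$ and each $t$, integers $r_{t,i}\ge0$ and $0\le s_{t,i}<n-1$ are defined by $i\lambda_t=r_{t,i}(n-1)+s_{t,i}$. -}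

module Defs where

open import Data.Nat as ℕ using (ℕ; zero; suc; _∸_; _%_)
open import Data.Nat.DivMod using (_/_)
open import Data.Fin using (Fin; zero; suc; _≟_)
open import Data.Integer as ℤ using (ℤ; +_)
open import Data.Rational as ℚ using (ℚ; 0ℚ; 1ℚ)
open import Data.Product using (Σ; _×_)
open import Relation.Nullary using (does)
open import Data.Bool using (if_then_else_)
open import Relation.Binary.PropositionalEquality using (_≡_)

sumℕ : (d : ℕ) → (Fin d → ℕ) → ℕ
sumℕ zero    f = 0
sumℕ (suc d) f = f zero ℕ.+ sumℕ d (λ i → f (suc i))

sumℚ : (d : ℕ) → (Fin d → ℚ) → ℚ
sumℚ zero    f = 0ℚ
sumℚ (suc d) f = f zero ℚ.+ sumℚ d (λ i → f (suc i))

IsPartition : (n d : ℕ) → (Fin d → ℕ) → Set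
IsPartition n d lam =
  ((t : Fin d) → 1 ℕ.≤ lam t) ×
  ((t u : Fin d) → Data.Fin._≤_ t u → lam u ℕ.≤ lam t) ×
  (sumℕ d lam ≡ n)

-- ⌈a / m⌉ for m ≥ 1 (value for m = 0 irrelevant)
ceilDiv : ℕ → ℕ → ℕ
ceilDiv a zero    = a
ceilDiv a (suc k) = (a ℕ.+ k) / suc k

modℕ : ℕ → ℕ → ℕ
modℕ a zero    = a
modℕ a (suc k) = a % suc k

s : (n d : ℕ) → (Fin d → ℕ) → Fin d → ℕ → ℕ
s n d lam t i = modℕ (i ℕ.* lam t) (n ∸ 1)

-- vectors in ℤ^{d+1} / ℚ^{d+1}: coordinate zero is the extra (first) coordinate,
-- coordinate (suc t) is the t-th coordinate of ℝ^d.
-- p(b) = ((Σ_t ⌈bλ_t/(n-1)⌉) - b, ⌈bλ_1/(n-1)⌉, ..., ⌈bλ_d/(n-1)⌉)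
p : (n d : ℕ) → (Fin d → ℕ) → ℕ → Fin (suc d) → ℤ
p n d lam b zero    = + sumℕ d (λ t → ceilDiv (b ℕ.* lam t) (n ∸ 1)) ℤ.- + b
p n d lam b (suc t) = + ceilDiv (b ℕ.* lam t) (n ∸ 1)

oneE : (d : ℕ) → Fin d → Fin (suc d) → ℚ
oneE d i zero    = 1ℚ
oneE d i (suc t) = if does (i ≟ t) then 1ℚ else 0ℚ

oneLam : (d : ℕ) → (Fin d → ℕ) → Fin (suc d) → ℚ
oneLam d lam zero    = 1ℚ
oneLam d lam (suc t) = (+ lam t) ℚ./ 1

-- x ∈ Π_λ : x = Σ_i γ_i (1,e_i) + γ_{d+1} (1,λ) with 0 ≤ γ_i < 1
-- (coefficients taken rational)
InΠ : (d : ℕ) → (Fin d → ℕ) → (Fin (suc d) → ℤ) → Set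
InΠ d lam x =
  Σ (Fin d → ℚ) λ γ → Σ ℚ λ γ' →
    ((i : Fin d) → 0ℚ ℚ.≤ γ i × γ i ℚ.< 1ℚ) ×
    (0ℚ ℚ.≤ γ' × γ' ℚ.< 1ℚ) ×
    ((k : Fin (suc d)) →
      sumℚ d (λ i → γ i ℚ.* oneE d i k) ℚ.+ γ' ℚ.* oneLam d lam k ≡ (x k ℚ./ 1))

-- the order of P(λ), transported to b ∈ {0,…,n-2} via b ↦ p(b):
-- σ ⪯ μ iff μ - σ ∈ Π_λ ∩ ℤ^{d+1}
Prec : (n d : ℕ) → (Fin d → ℕ) → ℕ → ℕ → Set
Prec n d lam i j = InΠ d lam (λ k → p n d lam j k ℤ.- p n d lam i k)

-- Write γ' for the coefficient of (1,λ) and γ_t for that of (1,e_t). The last d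
-- coordinates of x give γ_t + γ'λ_t = x_t and the first gives Σγ_t + γ' = x_0;
-- since Σλ_t = (n−1)+1 these force (n−1)γ' = Σ_t x_t − x_0, so an integer point has
-- exactly one candidate coefficient vector and lies in Π_λ iff its entries are in
-- [0,1). For x = p(j) − p(i) the coordinates are differences of ceilings, and
-- ⌈bλ_t/(n−1)⌉(n−1) = bλ_t + (n−1) − s_{t,b} because s_{t,b} ≠ 0 by coprimality;
-- this gives γ' = (j−i)/(n−1) and γ_t = (s_{t,i} − s_{t,j})/(n−1). Hence i ⪯ j iff
-- i ≤ j and s_{t,j} ≤ s_{t,i}, and the inequalities are strict because i ≠ j and
-- b ↦ s_{t,b} is injective on {1,…,n−2}.

module Submission where

open import Defs
open import Data.Nat using (ℕ; _≤_; _<_; _∸_; zero; suc; s≤s; z≤n; _+_; _*_; NonZero)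
open import Data.Nat.GCD using (gcd)
open import Data.Fin using (Fin; zero; suc)
open import Data.Product using (_×_; _,_; proj₁; proj₂)
open import Function.Bundles using (_⇔_; mk⇔; Equivalence)
open import Relation.Binary.PropositionalEquality
  using (_≡_; _≢_; refl; sym; trans; cong; cong₂; subst; subst₂; module ≡-Reasoning)

import Data.Nat as ℕ
import Data.Nat.Properties as ℕP
open import Data.Nat.Properties
  using (+-assoc; +-comm; +-cancelˡ-≡; *-comm; *-distribʳ-+; <⇒≱; m∸n≤m; m<n⇒0<n∸m; m+[n∸m]≡n)
open import Data.Nat.DivMod
  using (_/_; _%_; /-congˡ; m≡m%n+[m/n]*n; +-distrib-/-∣ʳ; m<n⇒m/n≡0; m*n/n≡m; m%n<n)
open import Data.Nat.Divisibility using (_∣_; ∣⇒≤; m%n≡0⇒n∣m; n∣m*n; ∣m+n∣m⇒∣n)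
open import Data.Nat.Coprimality using (Coprime; coprime-divisor; gcd≡1⇒coprime)
open import Data.Integer as ℤ using (ℤ; +_; +≤+; +<+)
import Data.Integer.Properties as ℤP
open import Data.Rational as ℚ using (ℚ; 0ℚ; 1ℚ; toℚᵘ)
import Data.Rational.Properties as ℚP
open import Data.Rational.Unnormalised as ℚᵘ using (mkℚᵘ; *≡*; *≤*; *<*)
import Data.Rational.Unnormalised.Properties as ℚᵘP
open import Data.Empty using (⊥-elim)
open import Relation.Nullary using (¬_)
open import Relation.Nullary.Decidable using (dec⇒maybe)
open import Level using (0ℓ)
import Tactic.RingSolver.Core.AlmostCommutativeRing as ACR
open import Tactic.RingSolver using (solve-∀)
import Data.Nat.Tactic.RingSolver as ℕ-Solver
import Data.Integer.Tactic.RingSolver as ℤ-Solver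

coprime⇒∤* : ∀ {k l e} → Coprime (suc k) l → 0 < e → e ≤ k → ¬ (suc k ∣ e * l)
coprime⇒∤* {k} {l} {e} c 0<e e≤k k+1∣el =
  <⇒≱ (s≤s e≤k) (∣⇒≤ {{ℕ.>-nonZero 0<e}} (coprime-divisor c (subst (suc k ∣_) (*-comm e l) k+1∣el)))

[m+n]%d≡m%d⇒d∣n : ∀ m n d .{{_ : NonZero d}} → (m + n) % d ≡ m % d → d ∣ n
[m+n]%d≡m%d⇒d∣n m n d eq = ∣m+n∣m⇒∣n (subst (d ∣_) key (n∣m*n ((m + n) / d))) (n∣m*n (m / d))
  where
  open ≡-Reasoning
  key : (m + n) / d * d ≡ m / d * d + n
  key = +-cancelˡ-≡ (m % d) _ _ (begin
    m % d + (m + n) / d * d       ≡⟨ cong (_+ (m + n) / d * d) (sym eq) ⟩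
    (m + n) % d + (m + n) / d * d ≡⟨ sym (m≡m%n+[m/n]*n (m + n) d) ⟩
    m + n                         ≡⟨ cong (_+ n) (m≡m%n+[m/n]*n m d) ⟩
    m % d + m / d * d + n         ≡⟨ +-assoc (m % d) _ n ⟩
    m % d + (m / d * d + n)       ∎)

0<[b*l]%[1+k] : ∀ {k l b} → Coprime (suc k) l → 0 < b → b ≤ k → 0 < (b * l) % suc k
0<[b*l]%[1+k] {k} {l} {b} c 0<b b≤k with (b * l) % suc k in eq
... | suc _ = s≤s z≤n
... | zero  = ⊥-elim (coprime⇒∤* c 0<b b≤k (m%n≡0⇒n∣m (b * l) (suc k) eq))

[i*l]%[1+k]≢[j*l]%[1+k] : ∀ {k l i j} → Coprime (suc k) l → i < j → j ≤ k →
                          (i * l) % suc k ≢ (j * l) % suc k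
[i*l]%[1+k]≢[j*l]%[1+k] {k} {l} {i} {j} c i<j j≤k eq =
  coprime⇒∤* c (m<n⇒0<n∸m i<j) (ℕP.≤-trans (m∸n≤m j i) j≤k)
    ([m+n]%d≡m%d⇒d∣n (i * l) ((j ∸ i) * l) (suc k) (trans (cong (_% suc k) jl≡) (sym eq)))
  where
  jl≡ : i * l + (j ∸ i) * l ≡ j * l
  jl≡ = trans (sym (*-distribʳ-+ l i (j ∸ i))) (cong (_* l) (m+[n∸m]≡n (ℕP.<⇒≤ i<j)))

ceilDiv-nonMultiple : ∀ m k → 0 < m % suc k → ceilDiv m (suc k) ≡ suc (m / suc k)
ceilDiv-nonMultiple m k 0<r
  with m % suc k | m≡m%n+[m/n]*n m (suc k) | m%n<n m (suc k)
... | suc r | m≡ | r<n = begin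
  (m + k) / suc k                         ≡⟨ /-congˡ (trans (cong (_+ k) m≡) (shift r q k)) ⟩
  (r + suc q * suc k) / suc k             ≡⟨ +-distrib-/-∣ʳ r (n∣m*n (suc q)) ⟩
  r / suc k + suc q * suc k / suc k       ≡⟨ cong₂ _+_ (m<n⇒m/n≡0 (ℕP.<-trans (ℕP.n<1+n r) r<n)) (m*n/n≡m (suc q) (suc k)) ⟩
  suc q                                   ∎
  where
  open ≡-Reasoning
  q : ℕ
  q = m / suc k
  shift : ∀ r q k → suc r + q * suc k + k ≡ r + suc q * suc k
  shift = ℕ-Solver.solve-∀

ceilDiv*n+m%n≡m+n : ∀ m k → 0 < m % suc k → ceilDiv m (suc k) * suc k + m % suc k ≡ m + suc k
ceilDiv*n+m%n≡m+n m k 0<r = begin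
  ceilDiv m (suc k) * suc k + m % suc k    ≡⟨ cong (λ c → c * suc k + m % suc k) (ceilDiv-nonMultiple m k 0<r) ⟩
  suc (m / suc k) * suc k + m % suc k      ≡⟨ +-assoc (suc k) _ (m % suc k) ⟩
  suc k + (m / suc k * suc k + m % suc k)  ≡⟨ cong (suc k ℕ.+_) (+-comm _ (m % suc k)) ⟩
  suc k + (m % suc k + m / suc k * suc k)  ≡⟨ cong (suc k ℕ.+_) (sym (m≡m%n+[m/n]*n m (suc k))) ⟩
  suc k + m                                ≡⟨ +-comm (suc k) m ⟩
  m + suc k                                ∎
  where open ≡-Reasoning

ι : ℤ → ℚ
ι a = a ℚ./ 1

1/suc : ℕ → ℚ
1/suc k = + 1 ℚ./ suc k

toℚᵘ-/suc : ∀ a k → toℚᵘ (a ℚ./ suc k) ℚᵘ.≃ mkℚᵘ a k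
toℚᵘ-/suc a k = ℚP.toℚᵘ-fromℚᵘ (mkℚᵘ a k)

toℚᵘ≃⇒≡ι : ∀ {p} a → toℚᵘ p ℚᵘ.≃ mkℚᵘ a 0 → p ≡ ι a
toℚᵘ≃⇒≡ι a p≃a = ℚP.toℚᵘ-injective (ℚᵘP.≃-trans p≃a (ℚᵘP.≃-sym (toℚᵘ-/suc a 0)))

ι-homo-+ : ∀ a b → ι (a ℤ.+ b) ≡ ι a ℚ.+ ι b
ι-homo-+ a b = sym (toℚᵘ≃⇒≡ι (a ℤ.+ b) (ℚᵘP.≃-trans (ℚP.toℚᵘ-homo-+ (ι a) (ι b))
  (ℚᵘP.≃-trans (ℚᵘP.+-cong (toℚᵘ-/suc a 0) (toℚᵘ-/suc b 0)) (*≡* (eq a b)))))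
  where
  eq : ∀ a b → (a ℤ.* + 1 ℤ.+ b ℤ.* + 1) ℤ.* + 1 ≡ (a ℤ.+ b) ℤ.* + 1
  eq = ℤ-Solver.solve-∀

ι-homo-* : ∀ a b → ι (a ℤ.* b) ≡ ι a ℚ.* ι b
ι-homo-* a b = sym (toℚᵘ≃⇒≡ι (a ℤ.* b) (ℚᵘP.≃-trans (ℚP.toℚᵘ-homo-* (ι a) (ι b))
  (ℚᵘP.≃-trans (ℚᵘP.*-cong (toℚᵘ-/suc a 0) (toℚᵘ-/suc b 0)) (*≡* refl))))

ι-homo-- : ∀ a b → ι (a ℤ.- b) ≡ ι a ℚ.- ι b
ι-homo-- a b = sym (toℚᵘ≃⇒≡ι (a ℤ.- b) (ℚᵘP.≃-trans (ℚP.toℚᵘ-homo-+ (ι a) (ℚ.- ι b))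
  (ℚᵘP.≃-trans (ℚᵘP.+-cong (toℚᵘ-/suc a 0) (ℚᵘP.≃-trans (ℚP.toℚᵘ-homo‿- (ι b)) (ℚᵘP.-‿cong (toℚᵘ-/suc b 0)))) (*≡* (eq a b)))))
  where
  eq : ∀ a b → (a ℤ.* + 1 ℤ.+ ℤ.- b ℤ.* + 1) ℤ.* + 1 ≡ (a ℤ.- b) ℤ.* + 1
  eq = ℤ-Solver.solve-∀

toℚᵘ-ι*1/suc : ∀ a k → toℚᵘ (ι a ℚ.* 1/suc k) ℚᵘ.≃ mkℚᵘ a k
toℚᵘ-ι*1/suc a k = ℚᵘP.≃-trans (ℚP.toℚᵘ-homo-* (ι a) (1/suc k))
  (ℚᵘP.≃-trans (ℚᵘP.*-cong (toℚᵘ-/suc a 0) (toℚᵘ-/suc (+ 1) k)) (*≡* (eq a (+ suc k))))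
  where
  eq : ∀ a m → (a ℤ.* + 1) ℤ.* m ≡ a ℤ.* (+ 1 ℤ.* m)
  eq = ℤ-Solver.solve-∀

ι*1/suc-cancel : ∀ a k → ι (a ℤ.* + suc k) ℚ.* 1/suc k ≡ ι a
ι*1/suc-cancel a k = toℚᵘ≃⇒≡ι a (ℚᵘP.≃-trans (toℚᵘ-ι*1/suc (a ℤ.* + suc k) k) (*≡* (ℤP.*-identityʳ (a ℤ.* + suc k))))

ι[1+k]*1/suc≡1 : ∀ k → ι (+ suc k) ℚ.* 1/suc k ≡ 1ℚ
ι[1+k]*1/suc≡1 k = subst (λ a → ι a ℚ.* 1/suc k ≡ 1ℚ) (ℤP.*-identityˡ (+ suc k)) (ι*1/suc-cancel (+ 1) k)

InUnit : ℚ → Set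
InUnit q = 0ℚ ℚ.≤ q × q ℚ.< 1ℚ

InUnit-ι*1/suc⇔ : ∀ a k → InUnit (ι a ℚ.* 1/suc k) ⇔ (ℤ.0ℤ ℤ.≤ a × a ℤ.< + suc k)
InUnit-ι*1/suc⇔ a k = mk⇔ to from
  where
  q≃ : toℚᵘ (ι a ℚ.* 1/suc k) ℚᵘ.≃ mkℚᵘ a k
  q≃ = toℚᵘ-ι*1/suc a k
  to : InUnit (ι a ℚ.* 1/suc k) → ℤ.0ℤ ℤ.≤ a × a ℤ.< + suc k
  to (0≤q , q<1) with ℚᵘP.≤-respʳ-≃ q≃ (ℚP.toℚᵘ-mono-≤ 0≤q) | ℚᵘP.<-respˡ-≃ q≃ (ℚP.toℚᵘ-mono-< q<1)
  ... | *≤* 0≤a | *<* a<k+1 = subst (ℤ.0ℤ ℤ.≤_) (ℤP.*-identityʳ a) 0≤a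
                            , subst₂ ℤ._<_ (ℤP.*-identityʳ a) (ℤP.*-identityˡ (+ suc k)) a<k+1
  from : ℤ.0ℤ ℤ.≤ a × a ℤ.< + suc k → InUnit (ι a ℚ.* 1/suc k)
  from (0≤a , a<k+1) =
      ℚP.toℚᵘ-cancel-≤ (ℚᵘP.≤-respʳ-≃ (ℚᵘP.≃-sym q≃) (*≤* (subst (ℤ.0ℤ ℤ.≤_) (sym (ℤP.*-identityʳ a)) 0≤a)))
    , ℚP.toℚᵘ-cancel-< (ℚᵘP.<-respˡ-≃ (ℚᵘP.≃-sym q≃)
        (*<* (subst₂ ℤ._<_ (sym (ℤP.*-identityʳ a)) (sym (ℤP.*-identityˡ (+ suc k))) a<k+1)))

InUnit-[m-n]*1/suc⇔ : ∀ {m n k} → m ≤ k → InUnit (ι (+ m ℤ.- + n) ℚ.* 1/suc k) ⇔ n ≤ m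
InUnit-[m-n]*1/suc⇔ {m} {n} {k} m≤k = mk⇔
  (λ unit → ℤP.drop‿+≤+ (ℤP.0≤i-j⇒j≤i (proj₁ (Equivalence.to criterion unit))))
  (λ n≤m → Equivalence.from criterion
    (ℤP.i≤j⇒0≤j-i (+≤+ n≤m) , ℤP.≤-<-trans (ℤP.i-j≤i (+ m) (+ n)) (+<+ (s≤s m≤k))))
  where
  criterion : InUnit (ι (+ m ℤ.- + n) ℚ.* 1/suc k) ⇔ (ℤ.0ℤ ℤ.≤ + m ℤ.- + n × + m ℤ.- + n ℤ.< + suc k)
  criterion = InUnit-ι*1/suc⇔ (+ m ℤ.- + n) k

ℚ-ring : ACR.AlmostCommutativeRing 0ℓ 0ℓ
ℚ-ring = ACR.fromCommutativeRing ℚP.+-*-commutativeRing (λ x → dec⇒maybe (0ℚ ℚP.≟ x))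

sumℚ-cong : ∀ d {f g : Fin d → ℚ} → (∀ t → f t ≡ g t) → sumℚ d f ≡ sumℚ d g
sumℚ-cong zero    f≗g = refl
sumℚ-cong (suc d) f≗g = cong₂ ℚ._+_ (f≗g zero) (sumℚ-cong d (λ t → f≗g (suc t)))

sumℚ-+-* : ∀ d (f : Fin d → ℚ) c g → sumℚ d (λ t → f t ℚ.+ c ℚ.* g t) ≡ sumℚ d f ℚ.+ c ℚ.* sumℚ d g
sumℚ-+-* zero    f c g = sym (trans (cong (0ℚ ℚ.+_) (ℚP.*-zeroʳ c)) (ℚP.+-identityˡ 0ℚ))
sumℚ-+-* (suc d) f c g =
  trans (cong (f zero ℚ.+ c ℚ.* g zero ℚ.+_) (sumℚ-+-* d (λ t → f (suc t)) c (λ t → g (suc t))))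
        (regroup (f zero) c (g zero) _ _)
  where
  regroup : ∀ a c b s r → a ℚ.+ c ℚ.* b ℚ.+ (s ℚ.+ c ℚ.* r) ≡ a ℚ.+ s ℚ.+ c ℚ.* (b ℚ.+ r)
  regroup = solve-∀ ℚ-ring

sumℚ-- : ∀ d (f g : Fin d → ℚ) → sumℚ d (λ t → f t ℚ.- g t) ≡ sumℚ d f ℚ.- sumℚ d g
sumℚ-- zero    f g = refl
sumℚ-- (suc d) f g =
  trans (cong (f zero ℚ.- g zero ℚ.+_) (sumℚ-- d (λ t → f (suc t)) (λ t → g (suc t))))
        (regroup (f zero) (g zero) _ _)
  where
  regroup : ∀ a b s r → a ℚ.- b ℚ.+ (s ℚ.- r) ≡ a ℚ.+ s ℚ.- (b ℚ.+ r)
  regroup = solve-∀ ℚ-ring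

sumℚ-ι : ∀ d (f : Fin d → ℕ) → sumℚ d (λ t → ι (+ f t)) ≡ ι (+ sumℕ d f)
sumℚ-ι zero    f = refl
sumℚ-ι (suc d) f = begin
  ι (+ f zero) ℚ.+ sumℚ d (λ t → ι (+ f (suc t)))  ≡⟨ cong (ι (+ f zero) ℚ.+_) (sumℚ-ι d (λ t → f (suc t))) ⟩
  ι (+ f zero) ℚ.+ ι (+ sumℕ d (λ t → f (suc t)))  ≡⟨ sym (ι-homo-+ (+ f zero) (+ sumℕ d (λ t → f (suc t)))) ⟩
  ι (+ f zero ℤ.+ + sumℕ d (λ t → f (suc t)))      ≡⟨ cong ι (sym (ℤP.pos-+ (f zero) (sumℕ d (λ t → f (suc t))))) ⟩
  ι (+ sumℕ (suc d) f)                             ∎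
  where open ≡-Reasoning

sumℚ-*0 : ∀ d (f : Fin d → ℚ) → sumℚ d (λ t → f t ℚ.* 0ℚ) ≡ 0ℚ
sumℚ-*0 zero    f = refl
sumℚ-*0 (suc d) f = cong₂ ℚ._+_ (ℚP.*-zeroʳ (f zero)) (sumℚ-*0 d (λ t → f (suc t)))

sumℚ-*oneE : ∀ d (γ : Fin d → ℚ) t → sumℚ d (λ i → γ i ℚ.* oneE d i (suc t)) ≡ γ t
sumℚ-*oneE (suc d) γ zero    =
  trans (cong₂ ℚ._+_ (ℚP.*-identityʳ (γ zero)) (sumℚ-*0 d (λ i → γ (suc i)))) (ℚP.+-identityʳ (γ zero))
sumℚ-*oneE (suc d) γ (suc t) =
  trans (cong₂ ℚ._+_ (ℚP.*-zeroʳ (γ zero)) (sumℚ-*oneE d (λ i → γ (suc i)) t)) (ℚP.+-identityˡ (γ (suc t)))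


-- k = n − 2 throughout, so M = n − 1.
module Parallelepiped {k d : ℕ} {lam : Fin d → ℕ} (Σλ≡k+2 : sumℕ d lam ≡ suc (suc k)) where

  M : ℚ
  M = ι (+ suc k)

  L : Fin d → ℚ
  L t = ι (+ lam t)

  coeffΛ : (Fin (suc d) → ℤ) → ℚ
  coeffΛ x = (sumℚ d (λ t → ι (x (suc t))) ℚ.- ι (x zero)) ℚ.* 1/suc k

  coeffE : (Fin (suc d) → ℤ) → Fin d → ℚ
  coeffE x t = ι (x (suc t)) ℚ.- coeffΛ x ℚ.* L t

  sumL≡M+1 : sumℚ d L ≡ M ℚ.+ 1ℚ
  sumL≡M+1 = begin
    sumℚ d L                  ≡⟨ sumℚ-ι d lam ⟩
    ι (+ sumℕ d lam)          ≡⟨ cong (λ m → ι (+ m)) (trans Σλ≡k+2 (+-comm 1 (suc k))) ⟩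
    ι (+ (suc k ℕ.+ 1))       ≡⟨ cong ι (ℤP.pos-+ (suc k) 1) ⟩
    ι (+ suc k ℤ.+ + 1)       ≡⟨ ι-homo-+ (+ suc k) (+ 1) ⟩
    M ℚ.+ 1ℚ                  ∎
    where open ≡-Reasoning

  sum-coords : ∀ (γ X : Fin d → ℚ) c → (∀ t → γ t ℚ.+ c ℚ.* L t ≡ X t) →
           sumℚ d γ ℚ.+ c ℚ.* (M ℚ.+ 1ℚ) ≡ sumℚ d X
  sum-coords γ X c coords = begin
    sumℚ d γ ℚ.+ c ℚ.* (M ℚ.+ 1ℚ)         ≡⟨ cong (λ s → sumℚ d γ ℚ.+ c ℚ.* s) (sym sumL≡M+1) ⟩
    sumℚ d γ ℚ.+ c ℚ.* sumℚ d L           ≡⟨ sym (sumℚ-+-* d γ c L) ⟩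
    sumℚ d (λ t → γ t ℚ.+ c ℚ.* L t)      ≡⟨ sumℚ-cong d coords ⟩
    sumℚ d X                              ∎
    where open ≡-Reasoning

  module _ (x : Fin (suc d) → ℤ) where

    private
      X : Fin d → ℚ
      X t = ι (x (suc t))

      height : ℚ
      height = sumℚ d X ℚ.- ι (x zero)

    coeffΛ*M : coeffΛ x ℚ.* M ≡ height
    coeffΛ*M = begin
      height ℚ.* 1/suc k ℚ.* M   ≡⟨ ℚP.*-assoc height (1/suc k) M ⟩
      height ℚ.* (1/suc k ℚ.* M) ≡⟨ cong (height ℚ.*_) (trans (ℚP.*-comm (1/suc k) M) (ι[1+k]*1/suc≡1 k)) ⟩
      height ℚ.* 1ℚ              ≡⟨ ℚP.*-identityʳ height ⟩
      height                     ∎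
      where open ≡-Reasoning

    InΠ⇒InUnit-coeffs : InΠ d lam x → InUnit (coeffΛ x) × (∀ t → InUnit (coeffE x t))
    InΠ⇒InUnit-coeffs (γ , γ' , γ∈ , γ'∈ , eqs) =
      subst InUnit γ'≡coeffΛ γ'∈ , λ t → subst InUnit (γ≡coeffE t) (γ∈ t)
      where
      coords : ∀ t → γ t ℚ.+ γ' ℚ.* L t ≡ X t
      coords t = trans (cong (ℚ._+ γ' ℚ.* L t) (sym (sumℚ-*oneE d γ t))) (eqs (suc t))

      coord₀ : sumℚ d γ ℚ.+ γ' ℚ.* 1ℚ ≡ ι (x zero)
      coord₀ = trans (cong (ℚ._+ γ' ℚ.* 1ℚ) (sumℚ-cong d (λ t → sym (ℚP.*-identityʳ (γ t))))) (eqs zero)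

      γ'*M≡height : γ' ℚ.* M ≡ height
      γ'*M≡height = trans (difference (sumℚ d γ) γ' M) (cong₂ ℚ._-_ (sum-coords γ X γ' coords) coord₀)
        where
        difference : ∀ s g m → g ℚ.* m ≡ (s ℚ.+ g ℚ.* (m ℚ.+ 1ℚ)) ℚ.- (s ℚ.+ g ℚ.* 1ℚ)
        difference = solve-∀ ℚ-ring

      γ'≡coeffΛ : γ' ≡ coeffΛ x
      γ'≡coeffΛ = begin
        γ'                         ≡⟨ sym (ℚP.*-identityʳ γ') ⟩
        γ' ℚ.* 1ℚ                  ≡⟨ cong (γ' ℚ.*_) (sym (ι[1+k]*1/suc≡1 k)) ⟩
        γ' ℚ.* (M ℚ.* 1/suc k)     ≡⟨ sym (ℚP.*-assoc γ' M (1/suc k)) ⟩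
        γ' ℚ.* M ℚ.* 1/suc k       ≡⟨ cong (ℚ._* 1/suc k) γ'*M≡height ⟩
        coeffΛ x                   ∎
        where open ≡-Reasoning

      γ≡coeffE : ∀ t → γ t ≡ coeffE x t
      γ≡coeffE t = trans (isolate (γ t) (γ' ℚ.* L t))
        (cong₂ (λ a b → a ℚ.- b ℚ.* L t) (coords t) γ'≡coeffΛ)
        where
        isolate : ∀ a b → a ≡ (a ℚ.+ b) ℚ.- b
        isolate = solve-∀ ℚ-ring

    InUnit-coeffs⇒InΠ : InUnit (coeffΛ x) × (∀ t → InUnit (coeffE x t)) → InΠ d lam x
    InUnit-coeffs⇒InΠ (Λ∈ , E∈) = coeffE x , coeffΛ x , E∈ , Λ∈ , eqs
      where
      c : ℚ
      c = coeffΛ x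

      coords : ∀ t → coeffE x t ℚ.+ c ℚ.* L t ≡ X t
      coords t = restore (X t) (c ℚ.* L t)
        where
        restore : ∀ a b → (a ℚ.- b) ℚ.+ b ≡ a
        restore = solve-∀ ℚ-ring

      coord₀ : sumℚ d (coeffE x) ℚ.+ c ℚ.* 1ℚ ≡ ι (x zero)
      coord₀ = begin
        sumℚ d (coeffE x) ℚ.+ c ℚ.* 1ℚ                          ≡⟨ difference (sumℚ d (coeffE x)) c M ⟩
        (sumℚ d (coeffE x) ℚ.+ c ℚ.* (M ℚ.+ 1ℚ)) ℚ.- c ℚ.* M    ≡⟨ cong₂ ℚ._-_ (sum-coords (coeffE x) X c coords) coeffΛ*M ⟩
        sumℚ d X ℚ.- (sumℚ d X ℚ.- ι (x zero))                  ≡⟨ cancel (sumℚ d X) (ι (x zero)) ⟩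
        ι (x zero)                                              ∎
        where
        open ≡-Reasoning
        difference : ∀ s g m → s ℚ.+ g ℚ.* 1ℚ ≡ (s ℚ.+ g ℚ.* (m ℚ.+ 1ℚ)) ℚ.- g ℚ.* m
        difference = solve-∀ ℚ-ring
        cancel : ∀ a b → a ℚ.- (a ℚ.- b) ≡ b
        cancel = solve-∀ ℚ-ring

      eqs : ∀ i → sumℚ d (λ t → coeffE x t ℚ.* oneE d t i) ℚ.+ c ℚ.* oneLam d lam i ≡ ι (x i)
      eqs zero    = trans (cong (ℚ._+ c ℚ.* 1ℚ) (sumℚ-cong d (λ t → ℚP.*-identityʳ (coeffE x t)))) coord₀
      eqs (suc t) = trans (cong (ℚ._+ c ℚ.* L t) (sumℚ-*oneE d (coeffE x) t)) (coords t)

module LatticePointDifference {k d : ℕ} {lam : Fin d → ℕ} (Σλ≡k+2 : sumℕ d lam ≡ suc (suc k))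
  (coprime : ∀ t → Coprime (suc k) (lam t)) where

  open Parallelepiped {k} {d} {lam} Σλ≡k+2

  C : ℕ → Fin d → ℕ
  C b t = ceilDiv (b * lam t) (suc k)

  S : ℕ → Fin d → ℕ
  S b t = (b * lam t) % suc k

  diff : ℕ → ℕ → Fin (suc d) → ℤ
  diff i j c = p (suc (suc k)) d lam j c ℤ.- p (suc (suc k)) d lam i c

  ceilDiv*M+S : ∀ {b} t → 0 < b → b ≤ k → + C b t ℤ.* + suc k ℤ.+ + S b t ≡ + b ℤ.* + lam t ℤ.+ + suc k
  ceilDiv*M+S {b} t 0<b b≤k = begin
    + C b t ℤ.* + suc k ℤ.+ + S b t  ≡⟨ cong (ℤ._+ + S b t) (sym (ℤP.pos-* (C b t) (suc k))) ⟩
    + (C b t * suc k) ℤ.+ + S b t    ≡⟨ sym (ℤP.pos-+ (C b t * suc k) (S b t)) ⟩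
    + (C b t * suc k + S b t)        ≡⟨ cong +_ (ceilDiv*n+m%n≡m+n (b * lam t) k (0<[b*l]%[1+k] (coprime t) 0<b b≤k)) ⟩
    + (b * lam t + suc k)            ≡⟨ ℤP.pos-+ (b * lam t) (suc k) ⟩
    + (b * lam t) ℤ.+ + suc k        ≡⟨ cong (ℤ._+ + suc k) (ℤP.pos-* b (lam t)) ⟩
    + b ℤ.* + lam t ℤ.+ + suc k      ∎
    where open ≡-Reasoning

  diff*M : ∀ {i j} t → 0 < i → i ≤ k → 0 < j → j ≤ k →
           diff i j (suc t) ℤ.* + suc k ≡ (+ S i t ℤ.- + S j t) ℤ.+ (+ j ℤ.- + i) ℤ.* + lam t
  diff*M {i} {j} t 0<i i≤k 0<j j≤k = begin
    (+ C j t ℤ.- + C i t) ℤ.* m                                   ≡⟨ expand (+ C j t) (+ C i t) m (+ S j t) (+ S i t) ⟩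
    (+ C j t ℤ.* m ℤ.+ + S j t) ℤ.- (+ C i t ℤ.* m ℤ.+ + S i t)
      ℤ.+ (+ S i t ℤ.- + S j t)                                   ≡⟨ cong₂ (λ a b → a ℤ.- b ℤ.+ (+ S i t ℤ.- + S j t))
                                                                          (ceilDiv*M+S t 0<j j≤k) (ceilDiv*M+S t 0<i i≤k) ⟩
    (+ j ℤ.* l ℤ.+ m) ℤ.- (+ i ℤ.* l ℤ.+ m) ℤ.+ (+ S i t ℤ.- + S j t) ≡⟨ collect (+ j) (+ i) l m (+ S i t ℤ.- + S j t) ⟩
    (+ S i t ℤ.- + S j t) ℤ.+ (+ j ℤ.- + i) ℤ.* l                 ∎
    where
    open ≡-Reasoning
    m l : ℤ
    m = + suc k
    l = + lam t
    expand : ∀ cj ci m sj si → (cj ℤ.- ci) ℤ.* m ≡ (cj ℤ.* m ℤ.+ sj) ℤ.- (ci ℤ.* m ℤ.+ si) ℤ.+ (si ℤ.- sj)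
    expand = ℤ-Solver.solve-∀
    collect : ∀ j i l m r → (j ℤ.* l ℤ.+ m) ℤ.- (i ℤ.* l ℤ.+ m) ℤ.+ r ≡ r ℤ.+ (j ℤ.- i) ℤ.* l
    collect = ℤ-Solver.solve-∀

  coeffΛ-diff : ∀ i j → coeffΛ (diff i j) ≡ ι (+ j ℤ.- + i) ℚ.* 1/suc k
  coeffΛ-diff i j = cong (ℚ._* 1/suc k) (begin
    sumℚ d (λ t → ι (+ C j t ℤ.- + C i t)) ℚ.- ι ((Σj ℤ.- + j) ℤ.- (Σi ℤ.- + i))
      ≡⟨ cong₂ ℚ._-_ (sumℚ-cong d (λ t → ι-homo-- (+ C j t) (+ C i t))) (ι-homo-- (Σj ℤ.- + j) (Σi ℤ.- + i)) ⟩
    sumℚ d (λ t → ι (+ C j t) ℚ.- ι (+ C i t)) ℚ.- (ι (Σj ℤ.- + j) ℚ.- ι (Σi ℤ.- + i))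
      ≡⟨ cong₂ ℚ._-_ (sumℚ-- d (λ t → ι (+ C j t)) (λ t → ι (+ C i t))) (cong₂ ℚ._-_ (ι-homo-- Σj (+ j)) (ι-homo-- Σi (+ i))) ⟩
    (sumℚ d (λ t → ι (+ C j t)) ℚ.- sumℚ d (λ t → ι (+ C i t))) ℚ.- ((ι Σj ℚ.- ι (+ j)) ℚ.- (ι Σi ℚ.- ι (+ i)))
      ≡⟨ cong₂ (λ a b → (a ℚ.- b) ℚ.- ((ι Σj ℚ.- ι (+ j)) ℚ.- (ι Σi ℚ.- ι (+ i)))) (sumℚ-ι d (C j)) (sumℚ-ι d (C i)) ⟩
    (ι Σj ℚ.- ι Σi) ℚ.- ((ι Σj ℚ.- ι (+ j)) ℚ.- (ι Σi ℚ.- ι (+ i)))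
      ≡⟨ cancel (ι Σj) (ι Σi) (ι (+ j)) (ι (+ i)) ⟩
    ι (+ j) ℚ.- ι (+ i)
      ≡⟨ sym (ι-homo-- (+ j) (+ i)) ⟩
    ι (+ j ℤ.- + i) ∎)
    where
    open ≡-Reasoning
    Σj Σi : ℤ
    Σj = + sumℕ d (C j)
    Σi = + sumℕ d (C i)
    cancel : ∀ a b c e → (a ℚ.- b) ℚ.- ((a ℚ.- c) ℚ.- (b ℚ.- e)) ≡ c ℚ.- e
    cancel = solve-∀ ℚ-ring

  coeffE-diff : ∀ {i j} t → 0 < i → i ≤ k → 0 < j → j ≤ k →
                coeffE (diff i j) t ≡ ι (+ S i t ℤ.- + S j t) ℚ.* 1/suc k
  coeffE-diff {i} {j} t 0<i i≤k 0<j j≤k = begin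
    ι x ℚ.- coeffΛ (diff i j) ℚ.* L t                        ≡⟨ cong₂ (λ a b → a ℚ.- b ℚ.* L t) (sym (ι*1/suc-cancel x k)) (coeffΛ-diff i j) ⟩
    ι (x ℤ.* + suc k) ℚ.* u ℚ.- ι δ ℚ.* u ℚ.* L t            ≡⟨ cong (λ a → ι a ℚ.* u ℚ.- ι δ ℚ.* u ℚ.* L t) (diff*M t 0<i i≤k 0<j j≤k) ⟩
    ι (r ℤ.+ δ ℤ.* + lam t) ℚ.* u ℚ.- ι δ ℚ.* u ℚ.* L t      ≡⟨ cong (λ a → a ℚ.* u ℚ.- ι δ ℚ.* u ℚ.* L t) (trans (ι-homo-+ r (δ ℤ.* + lam t)) (cong (ι r ℚ.+_) (ι-homo-* δ (+ lam t)))) ⟩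
    (ι r ℚ.+ ι δ ℚ.* L t) ℚ.* u ℚ.- ι δ ℚ.* u ℚ.* L t        ≡⟨ cancel (ι r) (ι δ) (L t) u ⟩
    ι r ℚ.* u                                                ∎
    where
    open ≡-Reasoning
    x δ r : ℤ
    x = diff i j (suc t)
    δ = + j ℤ.- + i
    r = + S i t ℤ.- + S j t
    u : ℚ
    u = 1/suc k
    cancel : ∀ a e l u → (a ℚ.+ e ℚ.* l) ℚ.* u ℚ.- e ℚ.* u ℚ.* l ≡ a ℚ.* u
    cancel = solve-∀ ℚ-ring

  Prec⇔≤-residues : ∀ {i j} → 0 < i → i ≤ k → 0 < j → j ≤ k →
                    Prec (suc (suc k)) d lam i j ⇔ (i ≤ j × (∀ t → S j t ≤ S i t))
  Prec⇔≤-residues {i} {j} 0<i i≤k 0<j j≤k = mk⇔ to from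
    where
    Λ-criterion : InUnit (ι (+ j ℤ.- + i) ℚ.* 1/suc k) ⇔ i ≤ j
    Λ-criterion = InUnit-[m-n]*1/suc⇔ {j} {i} j≤k

    E-criterion : ∀ t → InUnit (ι (+ S i t ℤ.- + S j t) ℚ.* 1/suc k) ⇔ S j t ≤ S i t
    E-criterion t = InUnit-[m-n]*1/suc⇔ {S i t} {S j t} (ℕ.s≤s⁻¹ (m%n<n (i * lam t) (suc k)))

    to : InΠ d lam (diff i j) → i ≤ j × (∀ t → S j t ≤ S i t)
    to prec = Equivalence.to Λ-criterion (subst InUnit (coeffΛ-diff i j) (proj₁ coeffs∈))
            , λ t → Equivalence.to (E-criterion t) (subst InUnit (coeffE-diff t 0<i i≤k 0<j j≤k) (proj₂ coeffs∈ t))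
      where
      coeffs∈ : InUnit (coeffΛ (diff i j)) × (∀ t → InUnit (coeffE (diff i j) t))
      coeffs∈ = InΠ⇒InUnit-coeffs (diff i j) prec

    from : i ≤ j × (∀ t → S j t ≤ S i t) → InΠ d lam (diff i j)
    from (i≤j , S≤) = InUnit-coeffs⇒InΠ (diff i j)
      ( subst InUnit (sym (coeffΛ-diff i j)) (Equivalence.from Λ-criterion i≤j)
      , λ t → subst InUnit (sym (coeffE-diff t 0<i i≤k 0<j j≤k)) (Equivalence.from (E-criterion t) (S≤ t)))

corollary2p18 : (n d : ℕ) (lam : Fin d → ℕ) → 2 ≤ n → IsPartition n d lam →
    ((t : Fin d) → gcd (n ∸ 1) (lam t) ≡ 1) →
    (i j : ℕ) → 1 ≤ i → i ≤ n ∸ 2 → 1 ≤ j → j ≤ n ∸ 2 → i ≢ j →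
    (Prec n d lam i j ⇔
      (i < j × ((t : Fin d) → s n d lam t j < s n d lam t i × 0 < s n d lam t j)))
corollary2p18 (suc zero) d lam (s≤s ()) _ _ _ _ _ _ _ _ _
corollary2p18 (suc (suc k)) d lam _ (_ , _ , Σλ≡n) gcd≡1 i j 0<i i≤k 0<j j≤k i≢j =
  mk⇔ to from
  where
  coprime : ∀ t → Coprime (suc k) (lam t)
  coprime t = gcd≡1⇒coprime (gcd≡1 t)
  open LatticePointDifference Σλ≡n coprime using (S; Prec⇔≤-residues)
  criterion : Prec (suc (suc k)) d lam i j ⇔ (i ≤ j × (∀ t → S j t ≤ S i t))
  criterion = Prec⇔≤-residues 0<i i≤k 0<j j≤k
  to : Prec (suc (suc k)) d lam i j → i < j × (∀ t → S j t < S i t × 0 < S j t)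
  to prec = i<j , λ t → ℕP.≤∧≢⇒< (proj₂ i≤j×S≤ t) (λ eq → [i*l]%[1+k]≢[j*l]%[1+k] (coprime t) i<j j≤k (sym eq))
                      , 0<[b*l]%[1+k] (coprime t) 0<j j≤k
    where
    i≤j×S≤ : i ≤ j × (∀ t → S j t ≤ S i t)
    i≤j×S≤ = Equivalence.to criterion prec
    i<j : i < j
    i<j = ℕP.≤∧≢⇒< (proj₁ i≤j×S≤) i≢j
  from : i < j × (∀ t → S j t < S i t × 0 < S j t) → Prec (suc (suc k)) d lam i j
  from (i<j , S<) = Equivalence.from criterion (ℕP.<⇒≤ i<j , λ t → ℕP.<⇒≤ (proj₁ (S< t)))
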